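{- Let $Z$ be a binary matroid and $q \in E(Z)$ with $Z \backslash q \cong M(K_4)$. Then $Z/q$ is graphic.
   Context: $M(K_4)$ is the cycle matroid of the complete graph on four vertices. (The matroid $Z/q$ is called a quotient of $M(K_4)$.) -}

module Defs where

open import Data.Nat using (ℕ; zero; suc; _<_)
open import Data.Nat.DivMod using (_mod_)
open import Data.Bool using (Bool; true; false; _∧_; _xor_; if_then_else_)
open import Data.Fin using (Fin; zero; suc; toℕ)
open import Data.Fin.Subset using (Subset; _∈_; _∉_; _⊆_; _∪_; ⁅_⁆; ∣_∣; Nonempty)
  renaming (⊥ to ∅)
open import Data.Fin.Permutation using (Permutation; _⟨$⟩ˡ_)
open import Data.Vec using (Vec; lookup; tabulate; insertAt; foldr)
open import Data.Product using (Σ; ∃; _×_; _,_)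
open import Data.Sum using (_⊎_)
open import Function.Base using (_∘_)
open import Function.Bundles using (_⇔_)
open import Function.Definitions using (Injective)
open import Relation.Binary.PropositionalEquality using (_≡_)
open import Relation.Nullary using (¬_)

Indep : ℕ → Set
Indep n = Subset n → Bool

record Matroid (n : ℕ) : Set where
  field
    indep    : Indep n
    empty    : indep ∅ ≡ true
    hered    : ∀ X Y → Y ⊆ X → indep X ≡ true → indep Y ≡ true
    augment  : ∀ X Y → indep X ≡ true → indep Y ≡ true → ∣ X ∣ < ∣ Y ∣ →
               ∃ λ e → e ∈ Y × e ∉ X × indep (X ∪ ⁅ e ⁆) ≡ true
open Matroid public

-- Binary matroids: representable over GF(2) (Bool with xor as addition)
-- by a matrix whose columns are labelled by the ground set.

colSum : ∀ {r n} → (Fin r → Fin n → Bool) → Subset n → Fin r → Bool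
colSum A Y i = foldr (λ _ → Bool) _xor_ false (tabulate (λ j → lookup Y j ∧ A i j))

-- The columns indexed by X are linearly independent over GF(2):
-- no nonempty subfamily sums to zero (coefficients over GF(2) are 0/1).
LinIndepCols : ∀ {r n} → (Fin r → Fin n → Bool) → Subset n → Set
LinIndepCols A X = ∀ Y → Y ⊆ X → Nonempty Y → ¬ (∀ i → colSum A Y i ≡ false)

Binary : ∀ {n} → Matroid n → Set
Binary {n} M = Σ ℕ λ r → Σ (Fin r → Fin n → Bool) λ A →
  ∀ X → (indep M X ≡ true) ⇔ LinIndepCols A X

-- Deletion and contraction of a single element q.  The ground set
-- E(M) - q is identified with Fin n via insertion at position q.

deletion : ∀ {n} → Matroid (suc n) → Fin (suc n) → Indep n
deletion M q X = indep M (insertAt X q false)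

contraction : ∀ {n} → Matroid (suc n) → Fin (suc n) → Indep n
contraction M q X =
  if indep M ⁅ q ⁆ then indep M (insertAt X q true) else indep M (insertAt X q false)

-- Graphs (multigraphs, loops allowed) with vertex set Fin v and edge
-- set Fin m; each edge has two (possibly equal) ends.

Graph : ℕ → ℕ → Set
Graph v m = Fin m → Fin v × Fin v

Joins : ∀ {v m} → Graph v m → Fin m → Fin v → Fin v → Set
Joins G e a b = (G e ≡ (a , b)) ⊎ (G e ≡ (b , a))

next : ∀ {k} → Fin (suc k) → Fin (suc k)
next {k} i = suc (toℕ i) mod (suc k)

record Cycle {v m} (G : Graph v m) (Y : Subset m) : Set where
  field
    k      : ℕ
    e      : Fin (suc k) → Fin m
    w      : Fin (suc k) → Fin v
    e-inj  : Injective _≡_ _≡_ e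
    w-inj  : Injective _≡_ _≡_ w
    e∈Y    : ∀ i → e i ∈ Y
    joins  : ∀ i → Joins G (e i) (w i) (w (next i))

Acyclic : ∀ {v m} → Graph v m → Subset m → Set
Acyclic G Y = ¬ Cycle G Y

image : ∀ {n m} → Permutation n m → Subset n → Subset m
image π X = tabulate (λ j → lookup X (π ⟨$⟩ˡ j))

IsoCycleMatroid : ∀ {n v m} → Indep n → Graph v m → Set
IsoCycleMatroid {n} {v} {m} I G = Σ (Permutation n m) λ π →
  ∀ X → (I X ≡ true) ⇔ Acyclic G (image π X)

Graphic : ∀ {n} → Indep n → Set
Graphic I = Σ ℕ λ v → Σ ℕ λ m → Σ (Graph v m) λ G → IsoCycleMatroid I G

K4 : Graph 4 6
K4 zero                                = (zero , suc zero)
K4 (suc zero)                          = (zero , suc (suc zero))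
K4 (suc (suc zero))                    = (zero , suc (suc (suc zero)))
K4 (suc (suc (suc zero)))              = (suc zero , suc (suc zero))
K4 (suc (suc (suc (suc zero))))        = (suc zero , suc (suc (suc zero)))
K4 (suc (suc (suc (suc (suc zero)))))  = (suc (suc zero) , suc (suc (suc zero)))

-- A binary matroid is determined by which sets of columns sum to zero.  Identify E(Z) − q
-- with the edges of K₄.  As Z \ q ≅ M(K₄), a set of edges sums to zero exactly when it lies
-- in the cycle space of K₄, whose nonempty members are circuits of K₄.  Hence the edge sets
-- summing to the column of q are either none, and then Z/q = Z \ q, or a coset of the cycle
-- space.  The coset is determined by the odd-degree vertices of its members: none (q is a
-- loop and Z/q = Z \ q), the ends of an edge f (q is parallel to f and Z/q = M(K₄/f)), or
-- all four (Z is the Fano plane and Z/q is a triangle with doubled edges).  Each candidate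
-- graph is then compared with Z/q on all 64 edge sets by evaluation, cycles being certified
-- by explicit witnesses and forests by pruning pendant edges.

module Submission where

open import Defs
open import Algebra.Bundles using (CommutativeRing)
open import Data.Bool using (Bool; true; false; _∧_; _∨_; not; _xor_; if_then_else_)
open import Data.Bool.ListAction using (any)
open import Data.Bool.Properties
  using (∧-conicalˡ; ∧-conicalʳ; ∧-distribʳ-xor; xor-assoc; xor-same; xor-identityʳ;
         xor-∧-commutativeRing; ¬-not; ⇔→≡)
  renaming (_≟_ to _≟ᴮ_)
open import Data.Empty using (⊥; ⊥-elim)
open import Data.Fin using (Fin; zero; suc; toℕ; fromℕ; inject₁; #_)
open import Data.Fin.Permutation using (Permutation; _⟨$⟩ʳ_; _⟨$⟩ˡ_; inverseˡ; flip)
open import Data.Fin.Properties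
  using (_≟_; any?; toℕ-injective; toℕ-fromℕ; toℕ-fromℕ<; toℕ-inject₁; toℕ<n)
open import Data.Fin.Subset using (Subset; _∈_; _⊆_; _-_; Nonempty; ⁅_⁆) renaming (⊥ to ∅)
open import Data.Fin.Subset.Properties
  using (_⊆?_; nonempty?; anySubset?; ⊆-refl; ⊆-min; ⊆-antisym; ∉⊥; Empty-unique;
         drop-∷-⊆; x∈p∧x≢y⇒x∈p-y)
open import Data.List using (List; []; _∷_)
open import Data.Maybe using (Maybe; just; nothing; maybe′)
open import Data.Nat using (ℕ; zero; suc; s≤s)
open import Data.Nat.DivMod using (_%_; n%n≡0; m<n⇒m%n≡m)
open import Data.Product using (Σ; ∃; ∃₂; _×_; _,_; proj₁; proj₂)
import Data.Product as Product
open import Data.Sum using (_⊎_; inj₁; inj₂)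
import Data.Sum as Sum
open import Data.Vec
  using (Vec; []; _∷_; here; there; lookup; zipWith; insertAt; removeAt)
open import Data.Vec.Properties
  using ([]=⇒lookup; lookup⇒[]=; ≡-dec; lookup∘tabulate; tabulate∘lookup; lookup-replicate;
         tabulate-cong; lookup-zipWith; insertAt-removeAt)
open import Function.Base using (_∘_)
open import Function.Bundles using (_⇔_; mk⇔; Equivalence)
open import Function.Construct.Composition using (_⇔-∘_)
open import Function.Definitions using (Injective)
open import Function.Properties.Equivalence using () renaming (sym to ⇔-sym)
open import Relation.Nullary using (Dec; yes; no; does; ¬_)
open import Relation.Nullary.Decidable using (dec-true; _×-dec_)
open import Relation.Binary.PropositionalEquality
  using (_≡_; _≢_; refl; sym; trans; cong; cong₂; subst; subst₂; module ≡-Reasoning)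
open import Algebra.Properties.CommutativeSemigroup
  (CommutativeRing.+-commutativeSemigroup xor-∧-commutativeRing) using (interchange)

open ≡-Reasoning

∧-intro : ∀ {a b} → a ≡ true → b ≡ true → a ∧ b ≡ true
∧-intro refl refl = refl

∨-elim : ∀ {a b} → a ∨ b ≡ true → a ≡ true ⊎ b ≡ true
∨-elim {true}  _ = inj₁ refl
∨-elim {false} p = inj₂ p

∨-introˡ : ∀ {a b} → a ≡ true → a ∨ b ≡ true
∨-introˡ refl = refl

∨-introʳ : ∀ {a b} → b ≡ true → a ∨ b ≡ true
∨-introʳ {true}  _ = refl
∨-introʳ {false} p = p

not-true : ∀ {a} → not a ≡ true → a ≡ false
not-true {false} _ = refl

true≢false : ∀ {a} → a ≡ true → a ≢ false
true≢false refl ()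

→-intro : ∀ {a b} → (a ≡ true → b ≡ true) → not a ∨ b ≡ true
→-intro {true}  f = f refl
→-intro {false} f = refl

→-elim : ∀ {a b} → not a ∨ b ≡ true → a ≡ true → b ≡ true
→-elim {true} p refl = p

_≡ᵇ_ : ∀ {n} → Fin n → Fin n → Bool
i ≡ᵇ j = does (i ≟ j)

≡ᵇ-sound : ∀ {n} {i j : Fin n} → i ≡ᵇ j ≡ true → i ≡ j
≡ᵇ-sound {i = i} {j} p with i ≟ j
... | yes i≡j = i≡j

≡⇒≡ᵇ : ∀ {n} {i j : Fin n} → i ≡ j → i ≡ᵇ j ≡ true
≡⇒≡ᵇ {i = i} i≡j = dec-true (i ≟ _) i≡j

allFin : ∀ {n} → (Fin n → Bool) → Bool
allFin {zero}  P = true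
allFin {suc n} P = P zero ∧ allFin (P ∘ suc)

allFin-sound : ∀ {n} {P : Fin n → Bool} → allFin P ≡ true → ∀ i → P i ≡ true
allFin-sound {suc n} {P} p zero    = ∧-conicalˡ (P zero) _ p
allFin-sound {suc n} {P} p (suc i) = allFin-sound (∧-conicalʳ (P zero) _ p) i

allFin-complete : ∀ {n} {P : Fin n → Bool} → (∀ i → P i ≡ true) → allFin P ≡ true
allFin-complete {zero}  f = refl
allFin-complete {suc n} f = ∧-intro (f zero) (allFin-complete (f ∘ suc))

allSubsets : ∀ {n} → (Subset n → Bool) → Bool
allSubsets {zero}  P = P []
allSubsets {suc n} P = allSubsets (P ∘ (true ∷_)) ∧ allSubsets (P ∘ (false ∷_))

allSubsets-sound : ∀ {n} {P : Subset n → Bool} → allSubsets P ≡ true → ∀ Y → P Y ≡ true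
allSubsets-sound {zero}  p []          = p
allSubsets-sound {suc n} {P} p (true ∷ Y)  =
  allSubsets-sound (∧-conicalˡ (allSubsets (P ∘ (true ∷_))) _ p) Y
allSubsets-sound {suc n} {P} p (false ∷ Y) =
  allSubsets-sound (∧-conicalʳ (allSubsets (P ∘ (true ∷_))) _ p) Y

allSubsets-complete : ∀ {n} {P : Subset n → Bool} → (∀ Y → P Y ≡ true) → allSubsets P ≡ true
allSubsets-complete {zero}  f = f []
allSubsets-complete {suc n} f =
  ∧-intro (allSubsets-complete (f ∘ (true ∷_))) (allSubsets-complete (f ∘ (false ∷_)))

injective? : ∀ {k n} → (Fin k → Fin n) → Bool
injective? f = allFin λ i → allFin λ j → not (f i ≡ᵇ f j) ∨ (i ≡ᵇ j)

injective?-sound : ∀ {k n} (f : Fin k → Fin n) → injective? f ≡ true → Injective _≡_ _≡_ f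
injective?-sound f p {i} {j} fi≡fj =
  ≡ᵇ-sound (→-elim (allFin-sound (allFin-sound p i) j) (≡⇒≡ᵇ fi≡fj))

-- Acyclicity of finite graphs

∈⇒lookup : ∀ {n} {Y : Subset n} {i} → i ∈ Y → lookup Y i ≡ true
∈⇒lookup = []=⇒lookup

lookup⇒∈ : ∀ {n} {Y : Subset n} {i} → lookup Y i ≡ true → i ∈ Y
lookup⇒∈ {Y = Y} {i} = lookup⇒[]= i Y

next-surjective : ∀ {k} (j : Fin (suc k)) → ∃ λ i → next i ≡ j
next-surjective {k} zero = fromℕ k , toℕ-injective (begin
  toℕ (next (fromℕ k))        ≡⟨ toℕ-fromℕ< _ ⟩
  suc (toℕ (fromℕ k)) % suc k ≡⟨ cong (λ z → suc z % suc k) (toℕ-fromℕ k) ⟩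
  suc k % suc k               ≡⟨ n%n≡0 (suc k) ⟩
  0                           ∎)
next-surjective {k} (suc j) = inject₁ j , toℕ-injective (begin
  toℕ (next (inject₁ j))          ≡⟨ toℕ-fromℕ< _ ⟩
  suc (toℕ (inject₁ j)) % suc k   ≡⟨ cong (λ z → suc z % suc k) (toℕ-inject₁ j) ⟩
  suc (toℕ j) % suc k             ≡⟨ m<n⇒m%n≡m (s≤s (toℕ<n j)) ⟩
  suc (toℕ j)                     ∎)

record CycleWitness (v m : ℕ) : Set where
  constructor _⟳_
  field
    {len}    : ℕ
    edges    : Vec (Fin m) (suc len)
    vertices : Vec (Fin v) (suc len)

module GraphCycles {v m : ℕ} (G : Graph v m) where

  incident? : Fin m → Fin v → Bool
  incident? f x = (proj₁ (G f) ≡ᵇ x) ∨ (proj₂ (G f) ≡ᵇ x)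

  joins?  : Fin m → Fin v → Fin v → Bool
  joins? f a b = (proj₁ (G f) ≡ᵇ a ∧ proj₂ (G f) ≡ᵇ b) ∨ (proj₁ (G f) ≡ᵇ b ∧ proj₂ (G f) ≡ᵇ a)

  joins?-sound : ∀ f a b → joins? f a b ≡ true → Joins G f a b
  joins?-sound f a b p with ∨-elim {proj₁ (G f) ≡ᵇ a ∧ proj₂ (G f) ≡ᵇ b} p
  ... | inj₁ q = inj₁ (cong₂ _,_ (≡ᵇ-sound (∧-conicalˡ _ _ q)) (≡ᵇ-sound (∧-conicalʳ _ _ q)))
  ... | inj₂ q = inj₂ (cong₂ _,_ (≡ᵇ-sound (∧-conicalˡ _ _ q)) (≡ᵇ-sound (∧-conicalʳ _ _ q)))

  joins⇒incidentˡ : ∀ {f a b} → Joins G f a b → incident? f a ≡ true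
  joins⇒incidentˡ     (inj₁ eq) = ∨-introˡ (≡⇒≡ᵇ (cong proj₁ eq))
  joins⇒incidentˡ {f} {a} (inj₂ eq) = ∨-introʳ {proj₁ (G f) ≡ᵇ a} (≡⇒≡ᵇ (cong proj₂ eq))

  joins⇒incidentʳ : ∀ {f a b} → Joins G f a b → incident? f b ≡ true
  joins⇒incidentʳ {f} {b = b} (inj₁ eq) = ∨-introʳ {proj₁ (G f) ≡ᵇ b} (≡⇒≡ᵇ (cong proj₂ eq))
  joins⇒incidentʳ     (inj₂ eq) = ∨-introˡ (≡⇒≡ᵇ (cong proj₁ eq))

  edgesIn? : ∀ {k} → Subset m → Vec (Fin m) k → Bool
  edgesIn? Y es = allFin λ i → lookup Y (lookup es i)

  closedWalk? : ∀ {k} → Vec (Fin m) (suc k) → Vec (Fin v) (suc k) → Bool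
  closedWalk? es ws = allFin λ i → joins? (lookup es i) (lookup ws i) (lookup ws (next i))

  isCycle? : Subset m → CycleWitness v m → Bool
  isCycle? Y (es ⟳ ws) =
    injective? (lookup es) ∧ injective? (lookup ws) ∧ edgesIn? Y es ∧ closedWalk? es ws

  isCycle?-sound : ∀ Y c → isCycle? Y c ≡ true → Cycle G Y
  isCycle?-sound Y (es ⟳ ws) p = record
    { e     = lookup es
    ; w     = lookup ws
    ; e-inj = injective?-sound (lookup es) (∧-conicalˡ (injective? (lookup es)) _ p)
    ; w-inj = injective?-sound (lookup ws) (∧-conicalˡ (injective? (lookup ws)) _ p₁)
    ; e∈Y   = λ i → lookup⇒∈ (allFin-sound {P = λ i → lookup Y (lookup es i)}
                                (∧-conicalˡ (edgesIn? Y es) _ p₂) i)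
    ; joins = λ i → joins?-sound _ _ _
                (allFin-sound {P = λ i → joins? (lookup es i) (lookup ws i) (lookup ws (next i))}
                              (∧-conicalʳ (edgesIn? Y es) _ p₂) i)
    }
    where
    p₁ : injective? (lookup ws) ∧ edgesIn? Y es ∧ closedWalk? es ws ≡ true
    p₁ = ∧-conicalʳ (injective? (lookup es)) _ p
    p₂ : edgesIn? Y es ∧ closedWalk? es ws ≡ true
    p₂ = ∧-conicalʳ (injective? (lookup ws)) _ p₁

  anyCycle? : List (CycleWitness v m) → Subset m → Bool
  anyCycle? cs Y = any (isCycle? Y) cs

  anyCycle?-sound : ∀ cs Y → anyCycle? cs Y ≡ true → Cycle G Y
  anyCycle?-sound (c ∷ cs) Y p with ∨-elim {isCycle? Y c} p
  ... | inj₁ q = isCycle?-sound Y c q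
  ... | inj₂ q = anyCycle?-sound cs Y q

  isLoop? : Fin m → Bool
  isLoop? f = proj₁ (G f) ≡ᵇ proj₂ (G f)

  pendantAt? : Subset m → Fin m → Fin v → Bool
  pendantAt? Y f x = allFin λ g → not (lookup Y g ∧ incident? g x) ∨ (g ≡ᵇ f)

  pendantAt?-sound : ∀ {Y f x} → pendantAt? Y f x ≡ true →
                     ∀ {g} → g ∈ Y → incident? g x ≡ true → g ≡ f
  pendantAt?-sound p {g} g∈Y g∼x =
    ≡ᵇ-sound (→-elim (allFin-sound p g) (∧-intro (∈⇒lookup g∈Y) g∼x))

  pendant? : Subset m → Fin m → Bool
  pendant? Y f = lookup Y f ∧ not (isLoop? f) ∧
                 (pendantAt? Y f (proj₁ (G f)) ∨ pendantAt? Y f (proj₂ (G f)))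

  module _ {Y : Subset m} (c : Cycle G Y) where
    open Cycle c

    on-pendant-vertex : ∀ {f} j → pendantAt? Y f (w j) ≡ true → e j ≡ f × next j ≡ j
    on-pendant-vertex {f} j p with next-surjective j
    ... | i , i↦j = eʲ≡f , subst (λ z → next z ≡ j) (e-inj (trans eⁱ≡f (sym eʲ≡f))) i↦j
      where
      eʲ≡f : e j ≡ f
      eʲ≡f = pendantAt?-sound p (e∈Y j) (joins⇒incidentˡ (joins j))
      eⁱ≡f : e i ≡ f
      eⁱ≡f = pendantAt?-sound p (e∈Y i)
               (subst (λ z → incident? (e i) (w z) ≡ true) i↦j (joins⇒incidentʳ (joins i)))

    fixed-point⇒loop : ∀ j → next j ≡ j → isLoop? (e j) ≡ true
    fixed-point⇒loop j j↦j with joins j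
    ... | inj₁ eq = ≡⇒≡ᵇ (trans (cong proj₁ eq) (sym (trans (cong proj₂ eq) (cong w j↦j))))
    ... | inj₂ eq = ≡⇒≡ᵇ (trans (trans (cong proj₁ eq) (cong w j↦j)) (sym (cong proj₂ eq)))

    end-on-cycle : ∀ i {x} → (x ≡ proj₁ (G (e i))) ⊎ (x ≡ proj₂ (G (e i))) →
                   ∃ λ j → x ≡ w j
    end-on-cycle i x≡end with joins i | x≡end
    ... | inj₁ eq | inj₁ x≡a = i , trans x≡a (cong proj₁ eq)
    ... | inj₁ eq | inj₂ x≡b = next i , trans x≡b (cong proj₂ eq)
    ... | inj₂ eq | inj₁ x≡a = next i , trans x≡a (cong proj₁ eq)
    ... | inj₂ eq | inj₂ x≡b = i , trans x≡b (cong proj₂ eq)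

    -- The pendant end of f lies on the cycle, where the cycle must turn back along f.
    pendant-end-on-cycle⇒loop : ∀ {f x} i → e i ≡ f → (x ≡ proj₁ (G f)) ⊎ (x ≡ proj₂ (G f)) →
                                pendantAt? Y f x ≡ true → isLoop? f ≡ true
    pendant-end-on-cycle⇒loop i refl x≡end p with end-on-cycle i x≡end
    ... | j , refl with on-pendant-vertex j p
    ...   | eʲ≡f , j↦j = subst (λ g → isLoop? g ≡ true) eʲ≡f (fixed-point⇒loop j j↦j)

    pendant-off-cycle : ∀ {f} → pendant? Y f ≡ true → ∀ i → e i ≢ f
    pendant-off-cycle {f} p i eⁱ≡f = true≢false loop (not-true (∧-conicalˡ (not (isLoop? f)) _ p′))
      where
      p′ : not (isLoop? f) ∧ (pendantAt? Y f (proj₁ (G f)) ∨ pendantAt? Y f (proj₂ (G f))) ≡ true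
      p′ = ∧-conicalʳ (lookup Y f) _ p
      loop : isLoop? f ≡ true
      loop with ∨-elim (∧-conicalʳ (not (isLoop? f)) _ p′)
      ... | inj₁ q = pendant-end-on-cycle⇒loop i eⁱ≡f (inj₁ refl) q
      ... | inj₂ q = pendant-end-on-cycle⇒loop i eⁱ≡f (inj₂ refl) q

    cycle-without-pendant : ∀ {f} → pendant? Y f ≡ true → Cycle G (Y - f)
    cycle-without-pendant p = record
      { e = e ; w = w ; e-inj = e-inj ; w-inj = w-inj ; joins = joins
      ; e∈Y = λ i → x∈p∧x≢y⇒x∈p-y (e∈Y i) (pendant-off-cycle p i) }

  strip : ℕ → Subset m → Bool
  strip fuel Y with nonempty? Y
  ... | no _ = true
  strip zero       Y | yes _ = false
  strip (suc fuel) Y | yes _ with any? (λ f → pendant? Y f ≟ᴮ true)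
  ... | yes (f , _) = strip fuel (Y - f)
  ... | no _        = false

  strip-sound : ∀ fuel Y → strip fuel Y ≡ true → Acyclic G Y
  strip-sound fuel Y p c with nonempty? Y
  ... | no empty = empty (Cycle.e c zero , Cycle.e∈Y c zero)
  strip-sound (suc fuel) Y p c | yes _ with any? (λ f → pendant? Y f ≟ᴮ true)
  ... | yes (f , q) = strip-sound fuel (Y - f) p (cycle-without-pendant c q)

  -- acyclic? cs decides acyclicity once every edge set is either
  -- certified cyclic by a member of cs or reduced to ∅ by stripping pendant edges.
  certified? : List (CycleWitness v m) → Bool
  certified? cs = allSubsets λ Y → anyCycle? cs Y ∨ strip m Y

  acyclic? : List (CycleWitness v m) → Subset m → Bool
  acyclic? cs Y = not (anyCycle? cs Y)

  acyclic?-correct : ∀ {cs} → certified? cs ≡ true → ∀ Y → acyclic? cs Y ≡ true ⇔ Acyclic G Y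
  acyclic?-correct {cs} cert Y with anyCycle? cs Y in eq
  ... | true  = mk⇔ (λ ()) (λ acyc → ⊥-elim (acyc (anyCycle?-sound cs Y eq)))
  ... | false = mk⇔ (λ _ → strip-sound m Y stripped) (λ _ → refl)
    where
    stripped : strip m Y ≡ true
    stripped = subst (λ b → b ∨ strip m Y ≡ true) eq (allSubsets-sound cert Y)

lookup-ext : ∀ {A : Set} {n} {xs ys : Vec A n} → (∀ i → lookup xs i ≡ lookup ys i) → xs ≡ ys
lookup-ext {xs = xs} {ys} eq =
  trans (sym (tabulate∘lookup xs)) (trans (tabulate-cong eq) (tabulate∘lookup ys))

-- Subsets as vectors over GF(2)

infixl 6 _⊕_
_⊕_ : ∀ {n} → Subset n → Subset n → Subset n
_⊕_ = zipWith _xor_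

⊕-cancelˡ : ∀ {n} (X Y : Subset n) → X ⊕ (X ⊕ Y) ≡ Y
⊕-cancelˡ []      []      = refl
⊕-cancelˡ (x ∷ X) (y ∷ Y) = cong₂ _∷_ (trans (sym (xor-assoc x x y)) (cong (_xor y) (xor-same x)))
                                      (⊕-cancelˡ X Y)

⊕-self : ∀ {n} (X : Subset n) → X ⊕ X ≡ ∅
⊕-self []      = refl
⊕-self (x ∷ X) = cong₂ _∷_ (xor-same x) (⊕-self X)

colSum-⊕ : ∀ {r n} (A : Fin r → Fin n → Bool) (X Y : Subset n) i →
           colSum A (X ⊕ Y) i ≡ colSum A X i xor colSum A Y i
colSum-⊕ A []      []      i = refl
colSum-⊕ A (x ∷ X) (y ∷ Y) i = begin
  ((x xor y) ∧ a) xor colSum A′ (X ⊕ Y) i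
    ≡⟨ cong₂ _xor_ (∧-distribʳ-xor a x y) (colSum-⊕ A′ X Y i) ⟩
  ((x ∧ a) xor (y ∧ a)) xor (colSum A′ X i xor colSum A′ Y i)
    ≡⟨ interchange (x ∧ a) (y ∧ a) (colSum A′ X i) (colSum A′ Y i) ⟩
  ((x ∧ a) xor colSum A′ X i) xor ((y ∧ a) xor colSum A′ Y i) ∎
  where
  a  = A i zero
  A′ = λ i j → A i (suc j)

∷-⊆ : ∀ {n s t} {p q : Subset n} → (s ≡ true → t ≡ true) → p ⊆ q → s ∷ p ⊆ t ∷ q
∷-⊆ s⇒t p⊆q here        = lookup⇒∈ (s⇒t refl)
∷-⊆ s⇒t p⊆q (there x∈p) = there (p⊆q x∈p)

head-⊆ : ∀ {n s t} {p q : Subset n} → s ∷ p ⊆ t ∷ q → s ≡ true → t ≡ true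
head-⊆ s∷p⊆t∷q refl = ∈⇒lookup (s∷p⊆t∷q here)

insertAt-⊆ : ∀ {n} (q : Fin (suc n)) {X Y : Subset n} {a b} →
             X ⊆ Y → (a ≡ true → b ≡ true) → insertAt X q a ⊆ insertAt Y q b
insertAt-⊆ zero                    X⊆Y a⇒b = ∷-⊆ a⇒b X⊆Y
insertAt-⊆ (suc q) {x ∷ X} {y ∷ Y} X⊆Y a⇒b =
  ∷-⊆ (head-⊆ X⊆Y) (insertAt-⊆ q (drop-∷-⊆ X⊆Y) a⇒b)

insertAt-⊆⁻ : ∀ {n} (q : Fin (suc n)) {X Y : Subset n} {a b} →
              insertAt X q a ⊆ insertAt Y q b → X ⊆ Y × (a ≡ true → b ≡ true)
insertAt-⊆⁻ zero                    s = drop-∷-⊆ s , head-⊆ s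
insertAt-⊆⁻ (suc q) {x ∷ X} {y ∷ Y} s =
  let X⊆Y , a⇒b = insertAt-⊆⁻ q (drop-∷-⊆ s) in ∷-⊆ (head-⊆ s) X⊆Y , a⇒b

insertAt-nonempty : ∀ {n} (q : Fin (suc n)) {X : Subset n} {a} →
                    a ≡ true ⊎ Nonempty X → Nonempty (insertAt X q a)
insertAt-nonempty zero              (inj₁ refl)          = zero , here
insertAt-nonempty zero              (inj₂ (x , x∈X))     = suc x , there x∈X
insertAt-nonempty (suc q) {x ∷ X}   (inj₁ a)             =
  let y , y∈ = insertAt-nonempty q {X} (inj₁ a) in suc y , there y∈
insertAt-nonempty (suc q) {x ∷ X}   (inj₂ (zero , here)) = zero , here
insertAt-nonempty (suc q) {x ∷ X}   (inj₂ (suc y , there y∈X)) =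
  let z , z∈ = insertAt-nonempty q (inj₂ (y , y∈X)) in suc z , there z∈

insertAt-nonempty⁻ : ∀ {n} (q : Fin (suc n)) {X : Subset n} {a} →
                     Nonempty (insertAt X q a) → a ≡ true ⊎ Nonempty X
insertAt-nonempty⁻ zero            (zero , here)      = inj₁ refl
insertAt-nonempty⁻ zero            (suc y , there y∈) = inj₂ (y , y∈)
insertAt-nonempty⁻ (suc q) {x ∷ X} (zero , here)      = inj₂ (zero , here)
insertAt-nonempty⁻ (suc q) {x ∷ X} (suc y , there y∈) =
  Sum.map₂ (λ (z , z∈) → suc z , there z∈) (insertAt-nonempty⁻ q (y , y∈))

insertAt-⊕ : ∀ {n} (X Y : Subset n) q a b → insertAt (X ⊕ Y) q (a xor b) ≡ insertAt X q a ⊕ insertAt Y q b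
insertAt-⊕ X       Y       zero    a b = refl
insertAt-⊕ (x ∷ X) (y ∷ Y) (suc q) a b = cong ((x xor y) ∷_) (insertAt-⊕ X Y q a b)

module _ {n m} (π : Permutation n m) where

  lookup-image : ∀ X j → lookup (image π X) j ≡ lookup X (π ⟨$⟩ˡ j)
  lookup-image X j = lookup∘tabulate (lookup X ∘ (π ⟨$⟩ˡ_)) j

  image-flip : ∀ X → image (flip π) (image π X) ≡ X
  image-flip X = lookup-ext λ i → begin
    lookup (image (flip π) (image π X)) i ≡⟨ lookup∘tabulate _ i ⟩
    lookup (image π X) (π ⟨$⟩ʳ i)        ≡⟨ lookup-image X (π ⟨$⟩ʳ i) ⟩
    lookup X (π ⟨$⟩ˡ (π ⟨$⟩ʳ i))          ≡⟨ cong (lookup X) (inverseˡ π) ⟩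
    lookup X i                           ∎

  image-⊕ : ∀ X Y → image π (X ⊕ Y) ≡ image π X ⊕ image π Y
  image-⊕ X Y = lookup-ext λ j → begin
    lookup (image π (X ⊕ Y)) j                    ≡⟨ lookup-image (X ⊕ Y) j ⟩
    lookup (X ⊕ Y) (π ⟨$⟩ˡ j)                      ≡⟨ lookup-zipWith _xor_ (π ⟨$⟩ˡ j) X Y ⟩
    lookup X (π ⟨$⟩ˡ j) xor lookup Y (π ⟨$⟩ˡ j)     ≡⟨ cong₂ _xor_ (lookup-image X j) (lookup-image Y j) ⟨
    lookup (image π X) j xor lookup (image π Y) j ≡⟨ lookup-zipWith _xor_ j (image π X) (image π Y) ⟨
    lookup (image π X ⊕ image π Y) j              ∎

  image-⊆ : ∀ {X Y} → X ⊆ Y → image π X ⊆ image π Y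
  image-⊆ {X} {Y} X⊆Y {j} j∈ = lookup⇒∈ (trans (lookup-image Y j)
    (∈⇒lookup (X⊆Y (lookup⇒∈ (trans (sym (lookup-image X j)) (∈⇒lookup j∈))))))

  image-nonempty : ∀ {X} → Nonempty X → Nonempty (image π X)
  image-nonempty {X} (x , x∈X) = π ⟨$⟩ʳ x , lookup⇒∈ (begin
    lookup (image π X) (π ⟨$⟩ʳ x) ≡⟨ lookup-image X (π ⟨$⟩ʳ x) ⟩
    lookup X (π ⟨$⟩ˡ (π ⟨$⟩ʳ x))   ≡⟨ cong (lookup X) (inverseˡ π) ⟩
    lookup X x                    ≡⟨ ∈⇒lookup x∈X ⟩
    true                          ∎)

image-∅ : ∀ {n m} (π : Permutation n m) → image π ∅ ≡ ∅
image-∅ π = lookup-ext λ j → begin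
  lookup (image π ∅) j ≡⟨ lookup-image π ∅ j ⟩
  lookup ∅ (π ⟨$⟩ˡ j)  ≡⟨ lookup-replicate (π ⟨$⟩ˡ j) false ⟩
  false               ≡⟨ lookup-replicate j false ⟨
  lookup ∅ j          ∎

insertAt-∅ : ∀ {n} (q : Fin (suc n)) → insertAt ∅ q true ≡ ⁅ q ⁆
insertAt-∅ zero            = refl
insertAt-∅ {suc n} (suc q) = cong (false ∷_) (insertAt-∅ q)

-- Binary single-element extensions

-- Independence of W ∪ {q | b} in a binary matroid, where V Y b′ says whether the columns
-- of Y ∪ {q | b′} sum to zero; the subsets of W ∪ {q | b} are the Y ∪ {q | b′}, Y ⊆ W, b′ ≤ b.
Independent : ∀ {k} → (Subset k → Bool → Bool) → Subset k → Bool → Set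
Independent V W b = (∀ {Y} → Y ⊆ W → Nonempty Y → V Y false ≡ false)
                  × (b ≡ true → ∀ {Y} → Y ⊆ W → V Y true ≡ false)

does⇒ : ∀ {P : Set} (d : Dec P) → does d ≡ true → P
does⇒ (yes p) _ = p

independent? : ∀ {k} → (Subset k → Bool → Bool) → Subset k → Bool → Bool
independent? V W b = allSubsets λ Y →
  not (does (Y ⊆? W)) ∨ ((not (does (nonempty? Y)) ∨ not (V Y false)) ∧ (not b ∨ not (V Y true)))

module _ {k} (V : Subset k → Bool → Bool) (W : Subset k) (b : Bool) where

  independent?-sound : independent? V W b ≡ true → Independent V W b
  independent?-sound i = (λ {Y} → without-q {Y}) , with-q
    where
    at : ∀ Y → Y ⊆ W →
         (not (does (nonempty? Y)) ∨ not (V Y false)) ∧ (not b ∨ not (V Y true)) ≡ true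
    at Y Y⊆W = →-elim (allSubsets-sound i Y) (dec-true (Y ⊆? W) Y⊆W)
    without-q : ∀ {Y} → Y ⊆ W → Nonempty Y → V Y false ≡ false
    without-q {Y} Y⊆W ne = not-true (→-elim (∧-conicalˡ _ _ (at Y Y⊆W)) (dec-true (nonempty? Y) ne))
    with-q : b ≡ true → ∀ {Y} → Y ⊆ W → V Y true ≡ false
    with-q b≡true {Y} Y⊆W =
      not-true (→-elim (∧-conicalʳ (not (does (nonempty? Y)) ∨ not (V Y false)) _ (at Y Y⊆W)) b≡true)

  independent?-complete : Independent V W b → independent? V W b ≡ true
  independent?-complete (ind₀ , ind₁) = allSubsets-complete λ Y → →-intro λ Y⊆W →
    let Y⊆W = does⇒ (Y ⊆? W) Y⊆W in
    ∧-intro (→-intro λ ne → cong not (ind₀ Y⊆W (does⇒ (nonempty? Y) ne)))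
            (→-intro λ b≡true → cong not (ind₁ b≡true Y⊆W))

Independent-≗ : ∀ {k} {V V′ : Subset k → Bool → Bool} → (∀ Y b → V Y b ≡ V′ Y b) →
                ∀ {W b} → Independent V W b ⇔ Independent V′ W b
Independent-≗ V≗V′ = mk⇔ (transport V≗V′) (transport (λ Y b → sym (V≗V′ Y b)))
  where
  transport : ∀ {V V′ : Subset _ → Bool → Bool} → (∀ Y b → V Y b ≡ V′ Y b) →
              ∀ {W b} → Independent V W b → Independent V′ W b
  transport eq (ind₀ , ind₁) = (λ {Y} Y⊆W ne → trans (sym (eq Y false)) (ind₀ Y⊆W ne))
                             , (λ b≡true {Y} Y⊆W → trans (sym (eq Y true)) (ind₁ b≡true Y⊆W))

Independent-∅ : ∀ {k} (V : Subset k → Bool → Bool) → Independent V ∅ true ⇔ V ∅ true ≡ false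
Independent-∅ V = mk⇔ (λ (_ , ind₁) → ind₁ refl ⊆-refl)
                      (λ v → (λ {Y} → empty-part {Y}) , λ _ {Y} → only-∅ v {Y})
  where
  empty-part : ∀ {Y} → Y ⊆ ∅ → Nonempty Y → V Y false ≡ false
  empty-part Y⊆∅ (x , x∈Y) = ⊥-elim (∉⊥ (Y⊆∅ x∈Y))
  only-∅ : V ∅ true ≡ false → ∀ {Y} → Y ⊆ ∅ → V Y true ≡ false
  only-∅ v {Y} Y⊆∅ = subst (λ Y → V Y true ≡ false) (sym (⊆-antisym Y⊆∅ (⊆-min Y))) v

Independent-true⇔false : ∀ {k} {V : Subset k → Bool → Bool} → (∀ Y → V Y true ≡ false) →
                         ∀ W → Independent V W true ⇔ Independent V W false
Independent-true⇔false never W = mk⇔ (λ ind → proj₁ ind , λ ()) (λ ind → proj₁ ind , λ _ {Y} _ → never Y)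

module BinaryExtension {r n} (A : Fin r → Fin (suc n) → Bool) (q : Fin (suc n))
                       (π : Permutation n 6) where

  -- π identifies E(Z) − q with E(K₄), and lift W b is W ∪ {q | b} ⊆ E(Z).
  lift : Subset 6 → Bool → Subset (suc n)
  lift W b = insertAt (image (flip π) W) q b

  vanishes : Subset 6 → Bool → Bool
  vanishes W b = allFin λ i → not (colSum A (lift W b) i)

  vanishes-sound : ∀ W b → vanishes W b ≡ true → ∀ i → colSum A (lift W b) i ≡ false
  vanishes-sound W b v i = not-true (allFin-sound v i)

  vanishes-complete : ∀ W b → (∀ i → colSum A (lift W b) i ≡ false) → vanishes W b ≡ true
  vanishes-complete W b z = allFin-complete λ i → cong not (z i)

  lift-image : ∀ X b → lift (image π X) b ≡ insertAt X q b
  lift-image X b = cong (λ Y → insertAt Y q b) (image-flip π X)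

  lift-∅ : lift ∅ true ≡ ⁅ q ⁆
  lift-∅ = trans (cong (λ Y → insertAt Y q true) (image-∅ (flip π))) (insertAt-∅ q)

  lift-cover : ∀ U → ∃₂ λ Y b → lift Y b ≡ U
  lift-cover U = image π (removeAt U q) , lookup U q ,
                 trans (lift-image (removeAt U q) (lookup U q)) (insertAt-removeAt U q)

  lift-⊕ : ∀ Y₁ Y₂ b₁ b₂ → lift (Y₁ ⊕ Y₂) (b₁ xor b₂) ≡ lift Y₁ b₁ ⊕ lift Y₂ b₂
  lift-⊕ Y₁ Y₂ b₁ b₂ = trans (cong (λ Y → insertAt Y q (b₁ xor b₂)) (image-⊕ (flip π) Y₁ Y₂))
                             (insertAt-⊕ _ _ q b₁ b₂)

  vanishes-⊕ : ∀ {Y₁ Y₂ b₁ b₂} → vanishes Y₁ b₁ ≡ true → vanishes Y₂ b₂ ≡ true →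
               vanishes (Y₁ ⊕ Y₂) (b₁ xor b₂) ≡ true
  vanishes-⊕ {Y₁} {Y₂} {b₁} {b₂} v₁ v₂ = vanishes-complete (Y₁ ⊕ Y₂) (b₁ xor b₂) λ i → begin
    colSum A (lift (Y₁ ⊕ Y₂) (b₁ xor b₂)) i
      ≡⟨ cong (λ U → colSum A U i) (lift-⊕ Y₁ Y₂ b₁ b₂) ⟩
    colSum A (lift Y₁ b₁ ⊕ lift Y₂ b₂) i
      ≡⟨ colSum-⊕ A (lift Y₁ b₁) (lift Y₂ b₂) i ⟩
    colSum A (lift Y₁ b₁) i xor colSum A (lift Y₂ b₂) i
      ≡⟨ cong₂ _xor_ (vanishes-sound Y₁ b₁ v₁ i) (vanishes-sound Y₂ b₂ v₂ i) ⟩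
    false ∎

  lift-⊆ : ∀ {Y W a b} → Y ⊆ W → (a ≡ true → b ≡ true) → lift Y a ⊆ lift W b
  lift-⊆ {Y} {W} Y⊆W = insertAt-⊆ q (image-⊆ (flip π) {Y} {W} Y⊆W)

  lift-⊆⁻ : ∀ {Y W a b} → lift Y a ⊆ lift W b → Y ⊆ W × (a ≡ true → b ≡ true)
  lift-⊆⁻ {Y} {W} s = let Y′⊆W′ , a⇒b = insertAt-⊆⁻ q s in
    subst₂ _⊆_ (image-flip (flip π) Y) (image-flip (flip π) W)
               (image-⊆ π {image (flip π) Y} {image (flip π) W} Y′⊆W′) , a⇒b

  lift-nonempty : ∀ {Y a} → a ≡ true ⊎ Nonempty Y → Nonempty (lift Y a)
  lift-nonempty = insertAt-nonempty q ∘ Sum.map₂ (image-nonempty (flip π))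

  lift-nonempty⁻ : ∀ {Y a} → Nonempty (lift Y a) → a ≡ true ⊎ Nonempty Y
  lift-nonempty⁻ {Y} = Sum.map₂ (subst Nonempty (image-flip (flip π) Y) ∘ image-nonempty π)
                     ∘ insertAt-nonempty⁻ q

  linIndep-lift⇔ : ∀ W b → LinIndepCols A (lift W b) ⇔ Independent vanishes W b
  linIndep-lift⇔ W b = mk⇔ to from
    where
    to : LinIndepCols A (lift W b) → Independent vanishes W b
    to li = (λ {Y} Y⊆W ne → ¬-not λ v →
               li (lift Y false) (lift-⊆ {Y} {W} Y⊆W λ ()) (lift-nonempty {Y} (inj₂ ne)) (vanishes-sound Y false v))
          , (λ b≡true {Y} Y⊆W → ¬-not λ v →
               li (lift Y true) (lift-⊆ {Y} {W} Y⊆W λ _ → b≡true) (lift-nonempty {Y} (inj₁ refl))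
                  (vanishes-sound Y true v))
    from : Independent vanishes W b → LinIndepCols A (lift W b)
    from (ind₀ , ind₁) U U⊆ ne z with lift-cover U
    ... | Y , true , refl = let Y⊆W , q⇒b = lift-⊆⁻ {Y} {W} U⊆ in
      true≢false (vanishes-complete Y true z) (ind₁ (q⇒b refl) Y⊆W)
    ... | Y , false , refl with lift-nonempty⁻ {Y} ne
    ...   | inj₂ neY = true≢false (vanishes-complete Y false z) (ind₀ (proj₁ (lift-⊆⁻ {Y} {W} U⊆)) neY)

≡⇒⇔ : ∀ {a b : Bool} → a ≡ b → (a ≡ true) ⇔ (b ≡ true)
≡⇒⇔ refl = mk⇔ (λ p → p) (λ p → p)

module _ {n} (M : Matroid (suc n)) (q : Fin (suc n)) where

  contraction-loop : indep M ⁅ q ⁆ ≡ false → ∀ X → contraction M q X ≡ deletion M q X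
  contraction-loop loop X = cong (λ c → if c then indep M (insertAt X q true) else deletion M q X) loop

  contraction-nonloop : indep M ⁅ q ⁆ ≡ true → ∀ X → contraction M q X ≡ indep M (insertAt X q true)
  contraction-nonloop nonloop X = cong (λ c → if c then indep M (insertAt X q true) else deletion M q X) nonloop

-- K₄, its cycle space, and the candidate graphs

_／_ : ∀ {v m} → Graph v m → Fin m → Graph v m
_／_ {v} G f g = Product.map merge merge (G g)
  where
  merge : Fin v → Fin v
  merge x = if x ≡ᵇ proj₂ (G f) then proj₁ (G f) else x

cyclesK4 : List (CycleWitness 4 6)
cyclesK4 =
  (# 0 ∷ # 3 ∷ # 1 ∷ []) ⟳ (# 0 ∷ # 1 ∷ # 2 ∷ []) ∷
  (# 0 ∷ # 4 ∷ # 5 ∷ # 1 ∷ []) ⟳ (# 0 ∷ # 1 ∷ # 3 ∷ # 2 ∷ []) ∷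
  (# 0 ∷ # 3 ∷ # 5 ∷ # 2 ∷ []) ⟳ (# 0 ∷ # 1 ∷ # 2 ∷ # 3 ∷ []) ∷
  (# 0 ∷ # 4 ∷ # 2 ∷ []) ⟳ (# 0 ∷ # 1 ∷ # 3 ∷ []) ∷
  (# 1 ∷ # 3 ∷ # 4 ∷ # 2 ∷ []) ⟳ (# 0 ∷ # 2 ∷ # 1 ∷ # 3 ∷ []) ∷
  (# 1 ∷ # 5 ∷ # 2 ∷ []) ⟳ (# 0 ∷ # 2 ∷ # 3 ∷ []) ∷
  (# 3 ∷ # 5 ∷ # 4 ∷ []) ⟳ (# 1 ∷ # 2 ∷ # 3 ∷ []) ∷
  []

cyclesK4／ : Fin 6 → List (CycleWitness 4 6)
cyclesK4／ zero =
  (# 0 ∷ []) ⟳ (# 0 ∷ []) ∷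
  (# 1 ∷ # 5 ∷ # 2 ∷ []) ⟳ (# 0 ∷ # 2 ∷ # 3 ∷ []) ∷
  (# 1 ∷ # 3 ∷ []) ⟳ (# 0 ∷ # 2 ∷ []) ∷
  (# 1 ∷ # 5 ∷ # 4 ∷ []) ⟳ (# 0 ∷ # 2 ∷ # 3 ∷ []) ∷
  (# 3 ∷ # 5 ∷ # 2 ∷ []) ⟳ (# 0 ∷ # 2 ∷ # 3 ∷ []) ∷
  (# 2 ∷ # 4 ∷ []) ⟳ (# 0 ∷ # 3 ∷ []) ∷
  (# 3 ∷ # 5 ∷ # 4 ∷ []) ⟳ (# 0 ∷ # 2 ∷ # 3 ∷ []) ∷
  []
cyclesK4／ (suc zero) =
  (# 0 ∷ # 4 ∷ # 2 ∷ []) ⟳ (# 0 ∷ # 1 ∷ # 3 ∷ []) ∷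
  (# 0 ∷ # 3 ∷ []) ⟳ (# 0 ∷ # 1 ∷ []) ∷
  (# 0 ∷ # 4 ∷ # 5 ∷ []) ⟳ (# 0 ∷ # 1 ∷ # 3 ∷ []) ∷
  (# 1 ∷ []) ⟳ (# 0 ∷ []) ∷
  (# 3 ∷ # 4 ∷ # 2 ∷ []) ⟳ (# 0 ∷ # 1 ∷ # 3 ∷ []) ∷
  (# 2 ∷ # 5 ∷ []) ⟳ (# 0 ∷ # 3 ∷ []) ∷
  (# 3 ∷ # 4 ∷ # 5 ∷ []) ⟳ (# 0 ∷ # 1 ∷ # 3 ∷ []) ∷
  []
cyclesK4／ (suc (suc zero)) =
  (# 0 ∷ # 3 ∷ # 1 ∷ []) ⟳ (# 0 ∷ # 1 ∷ # 2 ∷ []) ∷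
  (# 0 ∷ # 3 ∷ # 5 ∷ []) ⟳ (# 0 ∷ # 1 ∷ # 2 ∷ []) ∷
  (# 0 ∷ # 4 ∷ []) ⟳ (# 0 ∷ # 1 ∷ []) ∷
  (# 4 ∷ # 3 ∷ # 1 ∷ []) ⟳ (# 0 ∷ # 1 ∷ # 2 ∷ []) ∷
  (# 1 ∷ # 5 ∷ []) ⟳ (# 0 ∷ # 2 ∷ []) ∷
  (# 2 ∷ []) ⟳ (# 0 ∷ []) ∷
  (# 4 ∷ # 3 ∷ # 5 ∷ []) ⟳ (# 0 ∷ # 1 ∷ # 2 ∷ []) ∷
  []
cyclesK4／ (suc (suc (suc zero))) =
  (# 0 ∷ # 1 ∷ []) ⟳ (# 0 ∷ # 1 ∷ []) ∷
  (# 0 ∷ # 4 ∷ # 2 ∷ []) ⟳ (# 0 ∷ # 1 ∷ # 3 ∷ []) ∷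
  (# 0 ∷ # 5 ∷ # 2 ∷ []) ⟳ (# 0 ∷ # 1 ∷ # 3 ∷ []) ∷
  (# 1 ∷ # 4 ∷ # 2 ∷ []) ⟳ (# 0 ∷ # 1 ∷ # 3 ∷ []) ∷
  (# 1 ∷ # 5 ∷ # 2 ∷ []) ⟳ (# 0 ∷ # 1 ∷ # 3 ∷ []) ∷
  (# 3 ∷ []) ⟳ (# 1 ∷ []) ∷
  (# 4 ∷ # 5 ∷ []) ⟳ (# 1 ∷ # 3 ∷ []) ∷
  []
cyclesK4／ (suc (suc (suc (suc zero)))) =
  (# 0 ∷ # 3 ∷ # 1 ∷ []) ⟳ (# 0 ∷ # 1 ∷ # 2 ∷ []) ∷
  (# 0 ∷ # 5 ∷ # 1 ∷ []) ⟳ (# 0 ∷ # 1 ∷ # 2 ∷ []) ∷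
  (# 0 ∷ # 2 ∷ []) ⟳ (# 0 ∷ # 1 ∷ []) ∷
  (# 2 ∷ # 3 ∷ # 1 ∷ []) ⟳ (# 0 ∷ # 1 ∷ # 2 ∷ []) ∷
  (# 2 ∷ # 5 ∷ # 1 ∷ []) ⟳ (# 0 ∷ # 1 ∷ # 2 ∷ []) ∷
  (# 3 ∷ # 5 ∷ []) ⟳ (# 1 ∷ # 2 ∷ []) ∷
  (# 4 ∷ []) ⟳ (# 1 ∷ []) ∷
  []
cyclesK4／ (suc (suc (suc (suc (suc zero))))) =
  (# 0 ∷ # 3 ∷ # 1 ∷ []) ⟳ (# 0 ∷ # 1 ∷ # 2 ∷ []) ∷
  (# 0 ∷ # 4 ∷ # 1 ∷ []) ⟳ (# 0 ∷ # 1 ∷ # 2 ∷ []) ∷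
  (# 0 ∷ # 3 ∷ # 2 ∷ []) ⟳ (# 0 ∷ # 1 ∷ # 2 ∷ []) ∷
  (# 0 ∷ # 4 ∷ # 2 ∷ []) ⟳ (# 0 ∷ # 1 ∷ # 2 ∷ []) ∷
  (# 1 ∷ # 2 ∷ []) ⟳ (# 0 ∷ # 2 ∷ []) ∷
  (# 3 ∷ # 4 ∷ []) ⟳ (# 1 ∷ # 2 ∷ []) ∷
  (# 5 ∷ []) ⟳ (# 2 ∷ []) ∷
  []

-- M(K₄) + q with q = 01 + 23 is the Fano plane; contracting q makes the three pairs of
-- opposite edges of K₄ parallel.
doubledTriangle : Graph 4 6
doubledTriangle = lookup ((# 0 , # 1) ∷ (# 0 , # 2) ∷ (# 1 , # 2) ∷ (# 1 , # 2) ∷ (# 0 , # 2) ∷ (# 0 , # 1) ∷ [])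

cyclesDoubledTriangle : List (CycleWitness 4 6)
cyclesDoubledTriangle =
  (# 0 ∷ # 2 ∷ # 1 ∷ []) ⟳ (# 0 ∷ # 1 ∷ # 2 ∷ []) ∷
  (# 0 ∷ # 3 ∷ # 1 ∷ []) ⟳ (# 0 ∷ # 1 ∷ # 2 ∷ []) ∷
  (# 0 ∷ # 2 ∷ # 4 ∷ []) ⟳ (# 0 ∷ # 1 ∷ # 2 ∷ []) ∷
  (# 0 ∷ # 3 ∷ # 4 ∷ []) ⟳ (# 0 ∷ # 1 ∷ # 2 ∷ []) ∷
  (# 0 ∷ # 5 ∷ []) ⟳ (# 0 ∷ # 1 ∷ []) ∷
  (# 5 ∷ # 2 ∷ # 1 ∷ []) ⟳ (# 0 ∷ # 1 ∷ # 2 ∷ []) ∷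
  (# 5 ∷ # 3 ∷ # 1 ∷ []) ⟳ (# 0 ∷ # 1 ∷ # 2 ∷ []) ∷
  (# 1 ∷ # 4 ∷ []) ⟳ (# 0 ∷ # 2 ∷ []) ∷
  (# 2 ∷ # 3 ∷ []) ⟳ (# 1 ∷ # 2 ∷ []) ∷
  (# 5 ∷ # 2 ∷ # 4 ∷ []) ⟳ (# 0 ∷ # 1 ∷ # 2 ∷ []) ∷
  (# 5 ∷ # 3 ∷ # 4 ∷ []) ⟳ (# 0 ∷ # 1 ∷ # 2 ∷ []) ∷
  []

open GraphCycles using (incident?; acyclic?; certified?; acyclic?-correct)

acyclicK4? : Subset 6 → Bool
acyclicK4? = acyclic? K4 cyclesK4

acyclicK4?-correct : ∀ Y → acyclicK4? Y ≡ true ⇔ Acyclic K4 Y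
acyclicK4?-correct = acyclic?-correct K4 {cyclesK4} refl

-- K₄ has no loops, so this is the parity of the degree of x in Y.
oddAt : Subset 6 → Fin 4 → Bool
oddAt = colSum (λ x f → incident? K4 f x)

inCycleSpace : Subset 6 → Bool
inCycleSpace Y = allFin λ x → not (oddAt Y x)

cosetVanishing : Subset 6 → Subset 6 → Bool → Bool
cosetVanishing R Y false = inCycleSpace Y
cosetVanishing R Y true  = inCycleSpace (R ⊕ Y)

record ContractionGraph (R : Subset 6) : Set where
  field
    graph   : Graph 4 6
    cycles  : List (CycleWitness 4 6)
    checked : certified? graph cycles ∧
              allSubsets (λ W → does (independent? (cosetVanishing R) W true ≟ᴮ acyclic? graph cycles W))
              ≡ true

  certified : certified? graph cycles ≡ true
  certified = ∧-conicalˡ (certified? graph cycles) _ checked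

  agrees : ∀ W → independent? (cosetVanishing R) W true ≡ acyclic? graph cycles W
  agrees W = does⇒ (independent? (cosetVanishing R) W true ≟ᴮ acyclic? graph cycles W)
    (allSubsets-sound {P = λ W → does (independent? (cosetVanishing R) W true ≟ᴮ acyclic? graph cycles W)}
      (∧-conicalʳ (certified? graph cycles) _ checked) W)

  contraction-acyclic : ∀ W → Independent (cosetVanishing R) W true ⇔ Acyclic graph W
  contraction-acyclic W = mk⇔
    (λ ind → Equivalence.to (acyclic?-correct graph {cycles} certified W)
               (trans (sym (agrees W)) (independent?-complete (cosetVanishing R) W true ind)))
    (λ acyc → independent?-sound (cosetVanishing R) W true
               (trans (agrees W) (Equivalence.from (acyclic?-correct graph {cycles} certified W) acyc)))

parallelClass : ∀ f → ContractionGraph ⁅ f ⁆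
parallelClass f = record
  { graph   = K4 ／ f
  ; cycles  = cyclesK4／ f
  ; checked = allFin-sound
      {P = λ f → certified? (K4 ／ f) (cyclesK4／ f) ∧
                 allSubsets λ W → does (independent? (cosetVanishing ⁅ f ⁆) W true ≟ᴮ
                                        acyclic? (K4 ／ f) (cyclesK4／ f) W)}
      refl f
  }

fanoClass : ContractionGraph (true ∷ false ∷ false ∷ false ∷ false ∷ true ∷ [])
fanoClass = record { graph = doubledTriangle ; cycles = cyclesDoubledTriangle ; checked = refl }

-- The odd-degree vertices of Y determine its coset modulo the cycle space: two of them
-- are joined by a unique edge f, and four of them by the matching {01, 23}.
cosetTable : Bool → Bool → Bool → Bool → Maybe (Σ (Subset 6) ContractionGraph)
cosetTable true  true  false false = just (_ , parallelClass (# 0))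
cosetTable true  false true  false = just (_ , parallelClass (# 1))
cosetTable true  false false true  = just (_ , parallelClass (# 2))
cosetTable false true  true  false = just (_ , parallelClass (# 3))
cosetTable false true  false true  = just (_ , parallelClass (# 4))
cosetTable false false true  true  = just (_ , parallelClass (# 5))
cosetTable true  true  true  true  = just (_ , fanoClass)
cosetTable _     _     _     _     = nothing

cosetOf : Subset 6 → Maybe (Σ (Subset 6) ContractionGraph)
cosetOf Y = cosetTable (oddAt Y (# 0)) (oddAt Y (# 1)) (oddAt Y (# 2)) (oddAt Y (# 3))

representative : Subset 6 → Subset 6
representative Y = maybe′ proj₁ ∅ (cosetOf Y)

representative-coset : ∀ Y → inCycleSpace (Y ⊕ representative Y) ≡ true
representative-coset = allSubsets-sound {P = λ Y → inCycleSpace (Y ⊕ representative Y)} refl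

representative-acyclic : ∀ Y → Acyclic K4 (representative Y)
representative-acyclic Y = Equivalence.to (acyclicK4?-correct (representative Y))
  (allSubsets-sound {P = acyclicK4? ∘ representative} refl Y)

representative-∅ : ∀ Y → ¬ Nonempty (representative Y) → inCycleSpace Y ≡ true
representative-∅ Y empty
  with ∨-elim (allSubsets-sound {P = λ Y → does (nonempty? (representative Y)) ∨ inCycleSpace Y} refl Y)
... | inj₁ ne = ⊥-elim (empty (does⇒ (nonempty? _) ne))
... | inj₂ ev = ev

properSubsetsAcyclic? : Subset 6 → Subset 6 → Bool
properSubsetsAcyclic? C Y = not (does (Y ⊆? C)) ∨ does (≡-dec _≟ᴮ_ Y C) ∨ acyclicK4? Y

circuitK4? : Subset 6 → Bool
circuitK4? C = not (acyclicK4? C) ∧ allSubsets (properSubsetsAcyclic? C)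

cycleSpace-circuit : ∀ {C} → inCycleSpace C ≡ true → Nonempty C → circuitK4? C ≡ true
cycleSpace-circuit {C} ev ne =
  →-elim (allSubsets-sound {P = λ C → not (inCycleSpace C ∧ does (nonempty? C)) ∨ circuitK4? C} refl C)
         (∧-intro ev (dec-true (nonempty? C) ne))

circuit-dependent : ∀ {C} → circuitK4? C ≡ true → ¬ Acyclic K4 C
circuit-dependent {C} c acyc =
  true≢false (Equivalence.from (acyclicK4?-correct C) acyc) (not-true (∧-conicalˡ _ _ c))

circuit-minimal : ∀ {C Y} → circuitK4? C ≡ true → Y ⊆ C → Y ≢ C → Acyclic K4 Y
circuit-minimal {C} {Y} c Y⊆C Y≢C
  with ∨-elim (→-elim (allSubsets-sound {P = properSubsetsAcyclic? C} (∧-conicalʳ (not (acyclicK4? C)) _ c) Y)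
                      (dec-true (Y ⊆? C) Y⊆C))
... | inj₁ Y≡C  = ⊥-elim (Y≢C (does⇒ (≡-dec _≟ᴮ_ Y C) Y≡C))
... | inj₂ acyc = Equivalence.to (acyclicK4?-correct Y) acyc

module K4Extension (V : Subset 6 → Bool → Bool)
  (V-⊕ : ∀ {Y₁ Y₂ b₁ b₂} → V Y₁ b₁ ≡ true → V Y₂ b₂ ≡ true → V (Y₁ ⊕ Y₂) (b₁ xor b₂) ≡ true)
  (deletion : ∀ W → Independent V W false ⇔ Acyclic K4 W) where

  acyclic-nonvanishing : ∀ {Y} → Acyclic K4 Y → Nonempty Y → V Y false ≡ false
  acyclic-nonvanishing {Y} acyc = proj₁ (Equivalence.from (deletion Y) acyc) ⊆-refl

  -- a vanishing subset of C exists as C is dependent, and it is all of C by minimality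
  circuit-vanishes : ∀ {C} → inCycleSpace C ≡ true → Nonempty C → V C false ≡ true
  circuit-vanishes {C} ev ne with anySubset? (λ Y → (Y ⊆? C) ×-dec nonempty? Y ×-dec (V Y false ≟ᴮ true))
  ... | no none = ⊥-elim (circuit-dependent (cycleSpace-circuit ev ne)
                            (Equivalence.to (deletion C) ((λ {Y} → nonvanishing {Y}) , λ ())))
    where
    nonvanishing : ∀ {Y} → Y ⊆ C → Nonempty Y → V Y false ≡ false
    nonvanishing {Y} Y⊆C neY = ¬-not λ v → none (Y , Y⊆C , neY , v)
  ... | yes (Y , Y⊆C , neY , v) with ≡-dec _≟ᴮ_ Y C
  ...   | yes refl = v
  ...   | no  Y≢C  = ⊥-elim (true≢false v
                       (acyclic-nonvanishing (circuit-minimal (cycleSpace-circuit ev ne) Y⊆C Y≢C) neY))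

  ∅-vanishes : V ∅ false ≡ true
  ∅-vanishes = subst (λ Y → V Y false ≡ true) (⊕-self triangle) (V-⊕ t t)
    where
    triangle : Subset 6
    triangle = true ∷ true ∷ false ∷ true ∷ false ∷ false ∷ []
    t : V triangle false ≡ true
    t = circuit-vanishes {triangle} refl (# 0 , here)

  cycleSpace-vanishes : ∀ {Y} → inCycleSpace Y ≡ true → V Y false ≡ true
  cycleSpace-vanishes {Y} ev with nonempty? Y
  ... | yes ne    = circuit-vanishes ev ne
  ... | no  empty = subst (λ Y → V Y false ≡ true) (sym (Empty-unique empty)) ∅-vanishes

  coset-representative-vanishes : ∀ {Y b} → V Y b ≡ true → V (representative Y) b ≡ true
  coset-representative-vanishes {Y} {b} v =
    subst₂ (λ Z c → V Z c ≡ true) (⊕-cancelˡ Y (representative Y)) (xor-identityʳ b)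
      (V-⊕ v (cycleSpace-vanishes (representative-coset Y)))

  vanishing-in-cycleSpace : ∀ {Y} → V Y false ≡ true → inCycleSpace Y ≡ true
  vanishing-in-cycleSpace {Y} v = representative-∅ Y λ ne →
    true≢false (coset-representative-vanishes v) (acyclic-nonvanishing (representative-acyclic Y) ne)

  V-coset : ∀ {R} → V R true ≡ true → ∀ Y b → V Y b ≡ cosetVanishing R Y b
  V-coset vR Y false = ⇔→≡ {z = true} (mk⇔ vanishing-in-cycleSpace cycleSpace-vanishes)
  V-coset {R} vR Y true = ⇔→≡ {z = true} (mk⇔ (vanishing-in-cycleSpace ∘ V-⊕ vR)
    (λ ev → subst (λ Z → V Z true ≡ true) (⊕-cancelˡ R Y) (V-⊕ vR (cycleSpace-vanishes ev))))

  contraction-graph : V ∅ true ≡ false → Σ (Graph 4 6) λ G → ∀ W → Independent V W true ⇔ Acyclic G W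
  contraction-graph loopless with anySubset? (λ Y → V Y true ≟ᴮ true)
  ... | no none = K4 , λ W → deletion W ⇔-∘ Independent-true⇔false {V = V} (λ Y → ¬-not λ v → none (Y , v)) W
  ... | yes (Y , v) with cosetOf Y in eq
  ...   | nothing     = ⊥-elim (true≢false (subst (λ c → V (maybe′ proj₁ ∅ c) true ≡ true) eq
                                              (coset-representative-vanishes v)) loopless)
  ...   | just (R , C) = graph , λ W → contraction-acyclic W ⇔-∘ Independent-≗ (V-coset vR)
    where
    open ContractionGraph C
    vR : V R true ≡ true
    vR = subst (λ c → V (maybe′ proj₁ ∅ c) true ≡ true) eq (coset-representative-vanishes v)

lemma5p1 : ∀ {n} (Z : Matroid (suc n)) → Binary Z → (q : Fin (suc n)) →
    IsoCycleMatroid (deletion Z q) K4 → Graphic (contraction Z q)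
lemma5p1 Z (r , A , rep) q (π , iso) = 4 , 6 , contractionGraph
  where
  open BinaryExtension A q π

  indep-lift : ∀ W b → (indep Z (lift W b) ≡ true) ⇔ Independent vanishes W b
  indep-lift W b = linIndep-lift⇔ W b ⇔-∘ rep (lift W b)

  deletion-K4 : ∀ W → Independent vanishes W false ⇔ Acyclic K4 W
  deletion-K4 W = subst (λ U → (indep Z (lift W false) ≡ true) ⇔ Acyclic K4 U) (image-flip (flip π) W)
                        (iso (image (flip π) W))
                  ⇔-∘ ⇔-sym (indep-lift W false)

  open K4Extension vanishes (λ {Y₁ Y₂ b₁ b₂} → vanishes-⊕ {Y₁} {Y₂} {b₁} {b₂}) deletion-K4

  q-independent⇔ : (indep Z ⁅ q ⁆ ≡ true) ⇔ (vanishes ∅ true ≡ false)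
  q-independent⇔ = Independent-∅ vanishes
                   ⇔-∘ subst (λ U → (indep Z U ≡ true) ⇔ Independent vanishes ∅ true) lift-∅ (indep-lift ∅ true)

  contractionGraph : Σ (Graph 4 6) (IsoCycleMatroid (contraction Z q))
  contractionGraph with vanishes ∅ true in q-loop
  ... | true  = K4 , π , λ X → iso X ⇔-∘ ≡⇒⇔ (contraction-loop Z q q-dependent X)
    where
    q-dependent : indep Z ⁅ q ⁆ ≡ false
    q-dependent = ¬-not λ i → true≢false q-loop (Equivalence.to q-independent⇔ i)
  ... | false = let G , G-correct = contraction-graph q-loop in G , π , λ X →
    G-correct (image π X) ⇔-∘ (indep-lift (image π X) true ⇔-∘
      ≡⇒⇔ (trans (contraction-nonloop Z q (Equivalence.from q-independent⇔ q-loop) X)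
                 (cong (indep Z) (sym (lift-image X true)))))
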